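{- Let $G$ be a connected undirected graph and $P,Q$ simple paths in $G$ of length $k$. If the instance $(G,P,Q)$ has a reachable loose path, then every loose path for $(G,P,Q)$ is reachable.
   Context: The length of a path is its number of edges. A loose path for $(G,P,Q)$ is a simple path $R$ in $G$ of length $2k$ vertex-disjoint from both $P$ and $Q$; it is reachable if $P$ can be reconfigured into a path that uses at least one vertex of $R$. A reconfiguration step is a pair of edges $(e,f)$; it may be applied to a simple path when $f$ is one of its two end edges, $e$ is incident to the end vertex at the other end, and adding $e$ and removing $f$ yields another simple path (the result). $P$ can be reconfigured into $P'$ if some sequence of applicable steps takes $P$ to $P'$. -}

module Defs where

open import Level using (0ℓ)
open import Data.Nat using (ℕ; suc; _*_)
open import Data.Fin using (Fin)
open import Data.List using (List; []; _∷_; _∷ʳ_; length; reverse)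
open import Data.List.Relation.Unary.Linked using (Linked)
open import Data.List.Relation.Unary.Unique.Propositional using (Unique)
open import Data.List.Membership.Propositional using (_∈_)
open import Data.Product using (Σ; ∃; ∃-syntax; _×_)
open import Data.Sum using (_⊎_)
open import Data.Empty using (⊥)
open import Relation.Nullary using (¬_)
open import Relation.Binary.PropositionalEquality using (_≡_)
open import Relation.Binary.Construct.Closure.ReflexiveTransitive using (Star)

record Graph : Set₁ where
  field
    n    : ℕ
    Adj  : Fin n → Fin n → Set
    sym  : ∀ {u v} → Adj u v → Adj v u
    irr  : ∀ {v} → ¬ Adj v v

module _ (G : Graph) where
  open Graph G

  V : Set
  V = Fin n

  Connected : Set
  Connected = ∀ (u v : V) → Star Adj u v

  -- a simple path of length k (k edges), given by its vertex sequence
  -- v₀ v₁ … v_k: consecutive vertices adjacent, all vertices distinct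
  IsPath : ℕ → List V → Set
  IsPath k vs = length vs ≡ suc k × Linked Adj vs × Unique vs

  Disjoint : List V → List V → Set
  Disjoint xs ys = ∀ {x} → x ∈ xs → x ∈ ys → ⊥

  FwdStep : ℕ → List V → List V → Set
  FwdStep k P P′ =
    Σ V λ v → Σ (List V) λ zs → Σ V λ x → Σ V λ w →
      (P ≡ v ∷ (zs ∷ʳ x)) × (P′ ≡ (zs ∷ʳ x) ∷ʳ w) × Adj x w × IsPath k P′

  -- a reconfiguration step at either end (the other end is handled by
  -- reversing the vertex sequences)
  Step : ℕ → List V → List V → Set
  Step k P P′ = FwdStep k P P′ ⊎ FwdStep k (reverse P) (reverse P′)

  Reconf : ℕ → List V → List V → Set
  Reconf k = Star (Step k)

  Loose : ℕ → List V → List V → List V → Set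
  Loose k P Q R = IsPath (2 * k) R × Disjoint R P × Disjoint R Q

  Reachable : ℕ → List V → List V → Set
  Reachable k P R = ∃[ P′ ] (Reconf k P P′ × ∃[ x ] (x ∈ P′ × x ∈ R))

module Submission where

-- A path of length k ≥ 1 whose vertices form a window of k + 1
-- consecutive vertices of a simple path W can slide along W: each
-- reconfiguration step drops its first edge and adds the next edge of W
-- ('slide'); reversing all vertex sequences turns this into sliding
-- backwards ('rewind').
--
-- Let R′ be the given reachable loose path (2k + 1 vertices) and r any
-- vertex of the other loose path R.  A reconfiguration of P into a path
-- meeting R′ has a first step Pa → Pb with Pa disjoint from R′
-- ('first-crossing').  Such a step meets R′ only in its new end vertex w,
-- so Pb = M ++ [w] with M off R′.  One side of w on R′ has at least k
-- further vertices ('long-side'), and Pb slides through w along that side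
-- onto an end window of R′ ('enter').  By connectivity a path leaves R′ at
-- some vertex a and reaches r without returning ('depart').  If at least k
-- vertices of R′ precede a (otherwise reverse R′), the window rewinds to
-- the front of R′ and slides forward through a and out to r ('spread',
-- 'exit').  Hence P reconfigures into a path through r, so R is reachable.
-- For k = 0 no step exists at all.

open import Defs
open import Level using (0ℓ)
open import Data.Nat using (ℕ; zero; suc; _+_; _*_; _≤_; _≤?_; s≤s)
open import Data.Nat.Properties
  using (suc-injective; +-suc; +-identityʳ; +-cancelˡ-≤; +-monoˡ-≤; ≤-trans; ≤-reflexive;
         <⇒≤; ≰⇒>; m≤m+n; m≢1+n+m; m≤n⇒m⊓n≡m)
open import Data.Fin.Properties using (_≟_)
open import Data.List using (List; []; _∷_; _++_; _∷ʳ_; [_]; length; reverse; take; drop; initLast; _∷ʳ′_)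
open import Data.List.Properties
  using (++-assoc; ++-identityʳ; ∷-injective; length-++; length-reverse; length-take;
         take++drop≡id; reverse-++; reverse-involutive; unfold-reverse)
open import Data.List.Relation.Unary.Linked as Linked using (Linked; []; [-]; _∷_)
open import Data.List.Relation.Unary.AllPairs using ([]; _∷_)
open import Data.List.Relation.Unary.All using ([])
open import Data.List.Relation.Unary.All.Properties using (++⁻ˡ; ¬Any⇒All¬)
open import Data.List.Relation.Unary.Any using (Any; here; there; any?)
open import Data.List.Relation.Unary.Any.Properties using (reverse⁺; reverse⁻)
open import Data.List.Relation.Unary.Unique.Propositional using (Unique)
import Data.List.Relation.Unary.Unique.Propositional.Properties as Unique
open import Data.List.Membership.Propositional using (_∈_; lose; find)
open import Data.List.Membership.Propositional.Properties using (∈-++⁺ˡ; ∈-++⁻; ∈-∃++)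
open import Data.Product using (∃; ∃₂; ∃-syntax; _×_; _,_; proj₁; proj₂)
open import Data.Sum using (_⊎_; inj₁; inj₂)
open import Data.Empty using (⊥; ⊥-elim)
open import Relation.Nullary using (¬_; yes; no)
open import Relation.Unary using (Pred; Decidable)
open import Relation.Binary using (Rel; Symmetric)
open import Relation.Binary.PropositionalEquality
  using (_≡_; refl; sym; trans; cong; subst; subst₂; module ≡-Reasoning)
open import Relation.Binary.Construct.Closure.ReflexiveTransitive using (Star; ε; _◅_; _◅◅_)
open ≡-Reasoning

long-side : ∀ m a b → a + suc b ≡ suc (2 * m) → m ≤ a ⊎ m ≤ b
long-side m a b eq with m ≤? a
... | yes m≤a = inj₁ m≤a
... | no m≰a = inj₂ (+-cancelˡ-≤ m m b (≤-trans (≤-reflexive (sym a+b≡m+m)) (+-monoˡ-≤ b a≤m)))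
  where
  a+b≡m+m : a + b ≡ m + m
  a+b≡m+m = suc-injective (trans (sym (+-suc a b)) (trans eq (cong (λ t → suc (m + t)) (+-identityʳ m))))
  a≤m : a ≤ m
  a≤m = <⇒≤ (≰⇒> m≰a)

first-crossing : ∀ {A : Set} {R : Rel A 0ℓ} {P : Pred A 0ℓ} → Decidable P →
  ∀ {x y} → Star R x y → ¬ P x → P y →
  ∃₂ λ a b → Star R x a × ¬ P a × R a b × P b
first-crossing P? ε ¬px py = ⊥-elim (¬px py)
first-crossing P? {x} (_◅_ {j = b} x→b b→y) ¬px py with P? b
... | yes pb = x , b , ε , ¬px , x→b , pb
... | no ¬pb with first-crossing P? b→y ¬pb py
...   | a , c , b→a , ¬pa , a→c , pc = a , c , x→b ◅ b→a , ¬pa , a→c , pc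

module _ {A : Set} where

  some-member : ∀ {xs : List A} {m} → length xs ≡ suc m → ∃ λ x → x ∈ xs
  some-member {x ∷ _} _ = x , here refl

  length-snoc : ∀ (xs : List A) y → length (xs ∷ʳ y) ≡ suc (length xs)
  length-snoc [] y = refl
  length-snoc (x ∷ xs) y = cong suc (length-snoc xs y)

  reverse-split : ∀ (xs : List A) y ys → reverse (xs ++ y ∷ ys) ≡ reverse ys ++ y ∷ reverse xs
  reverse-split xs y ys = begin
    reverse (xs ++ y ∷ ys)         ≡⟨ reverse-++ xs (y ∷ ys) ⟩
    reverse (y ∷ ys) ++ reverse xs ≡⟨ cong (_++ reverse xs) (unfold-reverse y ys) ⟩
    (reverse ys ∷ʳ y) ++ reverse xs ≡⟨ ++-assoc (reverse ys) [ y ] (reverse xs) ⟩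
    reverse ys ++ y ∷ reverse xs   ∎

  split-length : ∀ {xs : List A} {U₁ a U₂ m} → xs ≡ U₁ ++ a ∷ U₂ → length xs ≡ m →
    length U₁ + suc (length U₂) ≡ m
  split-length {U₁ = U₁} refl len = trans (sym (length-++ U₁)) len

  equal-length-prefix : ∀ (xs : List A) {ys zs} → xs ++ ys ≡ zs → length xs ≡ length zs → xs ≡ zs
  equal-length-prefix [] {zs = []} _ _ = refl
  equal-length-prefix (x ∷ xs) {zs = z ∷ zs} eq len with ∷-injective eq
  ... | refl , eq′ = cong (x ∷_) (equal-length-prefix xs eq′ (suc-injective len))

  prefix-of-prefix : ∀ (xs : List A) {ys F G} → xs ++ ys ≡ F ++ G → length F ≤ length xs →
    ∃ λ H → xs ≡ F ++ H
  prefix-of-prefix xs {F = []} _ _ = xs , refl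
  prefix-of-prefix (x ∷ xs) {F = f ∷ F} eq (s≤s len) with ∷-injective eq
  ... | refl , eq′ with prefix-of-prefix xs eq′ len
  ...   | H , xs≡FH = H , cong (x ∷_) xs≡FH

  split-prefix : ∀ m (xs : List A) → m ≤ length xs → ∃₂ λ F H → xs ≡ F ++ H × length F ≡ m
  split-prefix m xs m≤ =
    take m xs , drop m xs , sym (take++drop≡id m xs) , trans (length-take m xs) (m≤n⇒m⊓n≡m m≤)

  split-suffix : ∀ m (xs : List A) → m ≤ length xs → ∃₂ λ C D → xs ≡ C ++ D × length D ≡ m
  split-suffix m xs m≤ with split-prefix m (reverse xs) (subst (m ≤_) (sym (length-reverse xs)) m≤)
  ... | F , H , rxs≡FH , lenF = reverse H , reverse F , xs≡ , trans (length-reverse F) lenF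
    where
    xs≡ : xs ≡ reverse H ++ reverse F
    xs≡ = trans (sym (reverse-involutive xs)) (trans (cong reverse rxs≡FH) (reverse-++ F H))

  end : A → List A → A
  end x [] = x
  end x (y ∷ ys) = end y ys

  end-∈ : ∀ x xs → end x xs ∈ x ∷ xs
  end-∈ x [] = here refl
  end-∈ x (y ∷ ys) = there (end-∈ y ys)

  end-++ : ∀ x (xs : List A) y ys → end x (xs ++ y ∷ ys) ≡ end y ys
  end-++ x [] y ys = refl
  end-++ x (z ∷ xs) y ys = end-++ z xs y ys

  end-∈-suffix : ∀ C d D U a E → C ++ d ∷ D ≡ U ++ a ∷ E → end a E ∈ d ∷ D
  end-∈-suffix C d D U a E eq = subst (_∈ d ∷ D) same-end (end-∈ d D)
    where
    same-end : end d D ≡ end a E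
    same-end = trans (sym (end-++ a C d D)) (trans (cong (end a) eq) (end-++ a U a E))

  unique-++ˡ : ∀ (xs : List A) {ys} → Unique (xs ++ ys) → Unique xs
  unique-++ˡ [] _ = []
  unique-++ˡ (x ∷ xs) (x∉ ∷ u) = ++⁻ˡ xs x∉ ∷ unique-++ˡ xs u

  unique-++ʳ : ∀ (xs : List A) {ys} → Unique (xs ++ ys) → Unique ys
  unique-++ʳ [] u = u
  unique-++ʳ (x ∷ xs) (_ ∷ u) = unique-++ʳ xs u

  unique-reverse : ∀ {xs : List A} → Unique xs → Unique (reverse xs)
  unique-reverse {[]} u = u
  unique-reverse {x ∷ xs} (x∉ ∷ u) = subst Unique (sym (unfold-reverse x xs))
    (Unique.++⁺ (unique-reverse u) ([] ∷ [])
      (λ { (p , here refl) → Unique.Unique[x∷xs]⇒x∉xs (x∉ ∷ u) (reverse⁻ p) }))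

  module _ {R : Rel A 0ℓ} where

    linked-++ˡ : ∀ (xs : List A) {ys} → Linked R (xs ++ ys) → Linked R xs
    linked-++ˡ [] _ = []
    linked-++ˡ (x ∷ []) _ = [-]
    linked-++ˡ (x ∷ y ∷ xs) (r ∷ l) = r ∷ linked-++ˡ (y ∷ xs) l

    linked-++ʳ : ∀ (xs : List A) {ys} → Linked R (xs ++ ys) → Linked R ys
    linked-++ʳ [] l = l
    linked-++ʳ (x ∷ xs) l = linked-++ʳ xs (Linked.tail l)

    linked-join : ∀ (xs : List A) {w ys} → Linked R (xs ∷ʳ w) → Linked R (w ∷ ys) → Linked R (xs ++ w ∷ ys)
    linked-join [] _ l = l
    linked-join (x ∷ []) (r ∷ _) l = r ∷ l
    linked-join (x ∷ y ∷ xs) (r ∷ l₁) l = r ∷ linked-join (y ∷ xs) l₁ l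

    linked-reverse : Symmetric R → ∀ {xs : List A} → Linked R xs → Linked R (reverse xs)
    linked-reverse R-sym {[]} l = l
    linked-reverse R-sym {x ∷ []} l = l
    linked-reverse R-sym {x ∷ y ∷ xs} (r ∷ l) =
      subst (Linked R) (sym reverse≡) (linked-join (reverse xs) rest (R-sym r ∷ [-]))
      where
      rest : Linked R (reverse xs ∷ʳ y)
      rest = subst (Linked R) (unfold-reverse y xs) (linked-reverse R-sym l)
      reverse≡ : reverse (x ∷ y ∷ xs) ≡ reverse xs ++ y ∷ x ∷ []
      reverse≡ = trans (unfold-reverse x (y ∷ xs))
        (trans (cong (_∷ʳ x) (unfold-reverse y xs)) (++-assoc (reverse xs) [ y ] [ x ]))

module _ (G : Graph) where
  open Graph G renaming (sym to Adj-sym)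
  open import Data.List.Membership.DecPropositional (_≟_ {n}) using (_∈?_)

  Simple : List (V G) → Set
  Simple xs = Linked Adj xs × Unique xs

  simple-++ˡ : ∀ xs {ys} → Simple (xs ++ ys) → Simple xs
  simple-++ˡ xs (l , u) = linked-++ˡ xs l , unique-++ˡ xs u

  simple-++ʳ : ∀ xs {ys} → Simple (xs ++ ys) → Simple ys
  simple-++ʳ xs (l , u) = linked-++ʳ xs l , unique-++ʳ xs u

  simple-reverse : ∀ {xs} → Simple xs → Simple (reverse xs)
  simple-reverse (l , u) = linked-reverse Adj-sym l , unique-reverse u

  path-reverse : ∀ {m xs} → IsPath G m xs → IsPath G m (reverse xs)
  path-reverse {xs = xs} (len , simple) = trans (length-reverse xs) len , simple-reverse simple

  simple-glue : ∀ xs {w ys} → Simple (xs ∷ʳ w) → Simple (w ∷ ys) → Disjoint G xs ys →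
    Simple (xs ++ w ∷ ys)
  simple-glue xs {w} {ys} (l₁ , u₁) (l₂ , w∉ys ∷ u₂) xs∩ys =
    linked-join xs l₁ l₂ ,
    subst Unique (++-assoc xs [ w ] ys) (Unique.++⁺ u₁ u₂ apart)
    where
    apart : ∀ {v} → ¬ (v ∈ xs ∷ʳ w × v ∈ ys)
    apart (p , q) with ∈-++⁻ xs p
    ... | inj₁ v∈xs = xs∩ys v∈xs q
    ... | inj₂ (here refl) = Unique.Unique[x∷xs]⇒x∉xs (w∉ys ∷ u₂) q

  reconf-reverse : ∀ {k P P′} → Reconf G k P P′ → Reconf G k (reverse P) (reverse P′)
  reconf-reverse ε = ε
  reconf-reverse {k} (inj₁ s ◅ ss) =
    inj₂ (subst₂ (FwdStep G k) (sym (reverse-involutive _)) (sym (reverse-involutive _)) s)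
    ◅ reconf-reverse ss
  reconf-reverse (inj₂ s ◅ ss) = inj₁ s ◅ reconf-reverse ss

  reconf-unreverse : ∀ {k P P′} → Reconf G k (reverse P) (reverse P′) → Reconf G k P P′
  reconf-unreverse {k} {P} {P′} rc =
    subst₂ (Reconf G k) (reverse-involutive P) (reverse-involutive P′) (reconf-reverse rc)

  Reaches : ℕ → List (V G) → V G → Set
  Reaches k S r = ∃ λ T → Reconf G k S T × r ∈ T

  reaches-back : ∀ {k S S′ r} → Reconf G k S S′ → Reaches k S′ r → Reaches k S r
  reaches-back S→S′ (T , S′→T , r∈T) = T , S→S′ ◅◅ S′→T , r∈T

  reaches-reverse : ∀ {k S r} → Reaches k (reverse S) r → Reaches k S r
  reaches-reverse {k} {S} (T , rS→T , r∈T) =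
    reverse T ,
    subst (λ X → Reconf G k X (reverse T)) (reverse-involutive S) (reconf-reverse rS→T) ,
    reverse⁺ r∈T

  -- A step produces at least two vertices, so paths of length 0 admit none.
  no-fwd-step-at-zero : ∀ {P P′} → FwdStep G zero P P′ → ⊥
  no-fwd-step-at-zero (_ , zs , x , w , _ , refl , _ , len , _)
    with trans (sym (trans (length-snoc (zs ∷ʳ x) w) (cong suc (length-snoc zs x)))) len
  ... | ()

  no-step-at-zero : ∀ {P P′} → Step G zero P P′ → ⊥
  no-step-at-zero (inj₁ s) = no-fwd-step-at-zero s
  no-step-at-zero (inj₂ s) = no-fwd-step-at-zero s

  advance : ∀ {k} v A′ b → length A′ ≡ suc k → Simple ((v ∷ A′) ∷ʳ b) →
    Step G (suc k) (v ∷ A′) (A′ ∷ʳ b)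
  advance v A′ b len simple with initLast A′
  advance v .[] b () simple | []
  advance v .(zs ∷ʳ x) b len simple | zs ∷ʳ′ x =
    inj₁ (v , zs , x , b , refl , refl , x~b ,
          trans (length-snoc (zs ∷ʳ x) b) (cong suc len) , simple-++ʳ [ v ] simple)
    where
    x~b : Adj x b
    x~b = Linked.head (linked-++ʳ (v ∷ zs)
      (subst (Linked Adj) (cong (v ∷_) (++-assoc zs [ x ] [ b ])) (proj₁ simple)))

  slide : ∀ {k} C {A B D} → Simple (A ++ B) → A ++ B ≡ C ++ D →
    length A ≡ suc (suc k) → length D ≡ suc (suc k) → Reconf G (suc k) A D
  slide [] {A} simple eq lenA lenD =
    subst (Reconf G _ A) (equal-length-prefix A eq (trans lenA (sym lenD))) ε
  slide (c ∷ C) {[]} simple eq () lenD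
  slide (c ∷ C) {v ∷ A′} {[]} {D} simple eq lenA lenD = ⊥-elim (m≢1+n+m (length D) D-longer)
    where
    D-longer : length D ≡ suc (length C + length D)
    D-longer = begin
      length D                 ≡⟨ trans lenD (sym lenA) ⟩
      length (v ∷ A′)          ≡⟨ cong length (sym (++-identityʳ (v ∷ A′))) ⟩
      length ((v ∷ A′) ++ [])  ≡⟨ cong length eq ⟩
      suc (length (C ++ D))    ≡⟨ cong suc (length-++ C) ⟩
      suc (length C + length D) ∎
  slide {k} (c ∷ C) {v ∷ A′} {b ∷ B} {D} simple eq lenA lenD =
    advance v A′ b (suc-injective lenA) (simple-++ˡ ((v ∷ A′) ∷ʳ b) simple′)
    ◅ slide C (simple-++ʳ [ v ] simple′) eq′ (trans (length-snoc A′ b) lenA) lenD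
    where
    simple′ : Simple (((v ∷ A′) ∷ʳ b) ++ B)
    simple′ = subst Simple (sym (++-assoc (v ∷ A′) [ b ] B)) simple
    eq′ : (A′ ∷ʳ b) ++ B ≡ C ++ D
    eq′ = trans (++-assoc A′ [ b ] B) (proj₂ (∷-injective eq))

  rewind : ∀ {k W F H C S} → Simple W → W ≡ F ++ H → W ≡ C ++ S →
    length F ≡ suc (suc k) → length S ≡ suc (suc k) → Reconf G (suc k) S F
  rewind {W = W} {F} {H} {C} {S} simple W≡FH W≡CS lenF lenS =
    reconf-unreverse (slide (reverse H) (subst Simple rW≡SC (simple-reverse simple))
      (trans (sym rW≡SC) rW≡HF) (trans (length-reverse S) lenS) (trans (length-reverse F) lenF))
    where
    rW≡SC : reverse W ≡ reverse S ++ reverse C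
    rW≡SC = trans (cong reverse W≡CS) (reverse-++ C S)
    rW≡HF : reverse W ≡ reverse H ++ reverse F
    rW≡HF = trans (cong reverse W≡FH) (reverse-++ F H)

  exit : ∀ {k W F H U₁ a U₂ E} → Simple W → W ≡ F ++ H → length F ≡ suc (suc k) →
    W ≡ U₁ ++ a ∷ U₂ → suc k ≤ length U₁ → Simple (a ∷ E) → Disjoint G E W →
    Reaches (suc k) F (end a E)
  exit {k} {W} {F} {H} {U₁} {a} {U₂} {E} simple W≡FH lenF W≡U k≤U₁ simpleE E∩W =
    along (prefix-of-prefix (U₁ ∷ʳ a) (trans (sym W≡U₁a++U₂) W≡FH) F≤U₁a)
    where
    W≡U₁a++U₂ : W ≡ (U₁ ∷ʳ a) ++ U₂
    W≡U₁a++U₂ = trans W≡U (sym (++-assoc U₁ [ a ] U₂))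
    F≤U₁a : length F ≤ length (U₁ ∷ʳ a)
    F≤U₁a = subst₂ _≤_ (sym lenF) (sym (length-snoc U₁ a)) (s≤s k≤U₁)
    simple-route : Simple (U₁ ++ a ∷ E)
    simple-route = simple-glue U₁ (simple-++ˡ (U₁ ∷ʳ a) (subst Simple W≡U₁a++U₂ simple)) simpleE
      (λ u∈U₁ u∈E → E∩W u∈E (subst (_ ∈_) (sym W≡U) (∈-++⁺ˡ u∈U₁)))
    along : (∃ λ J → U₁ ∷ʳ a ≡ F ++ J) → Reaches (suc k) F (end a E)
    along (J , U₁a≡FJ) = to-end (split-suffix (suc (suc k)) (U₁ ++ a ∷ E) F≤route)
      where
      route≡ : U₁ ++ a ∷ E ≡ F ++ (J ++ E)
      route≡ = begin
        U₁ ++ a ∷ E     ≡⟨ sym (++-assoc U₁ [ a ] E) ⟩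
        (U₁ ∷ʳ a) ++ E  ≡⟨ cong (_++ E) U₁a≡FJ ⟩
        (F ++ J) ++ E   ≡⟨ ++-assoc F J E ⟩
        F ++ (J ++ E)   ∎
      F≤route : suc (suc k) ≤ length (U₁ ++ a ∷ E)
      F≤route = subst₂ _≤_ lenF (sym (trans (cong length route≡) (length-++ F))) (m≤m+n (length F) _)
      to-end : (∃₂ λ C D → U₁ ++ a ∷ E ≡ C ++ D × length D ≡ suc (suc k)) →
        Reaches (suc k) F (end a E)
      to-end (C , [] , _ , ())
      to-end (C , d ∷ D , route≡CD , lenD) =
        d ∷ D ,
        slide C (subst Simple route≡ simple-route) (trans (sym route≡) route≡CD) lenF lenD ,
        end-∈-suffix C d D U₁ a E (sym route≡CD)

  walk⇒path : ∀ {u v} → Star Adj u v → ∃ λ L → Simple (u ∷ L) × end u L ≡ v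
  walk⇒path ε = [] , ([-] , [] ∷ []) , refl
  walk⇒path {u} (_◅_ {j = y} u~y y→v) with walk⇒path y→v
  ... | L , (l , uq) , end≡ with u ∈? (y ∷ L)
  ...   | no u∉ = y ∷ L , (u~y ∷ l , ¬Any⇒All¬ (y ∷ L) u∉ ∷ uq) , end≡
  ...   | yes u∈ with ∈-∃++ u∈
  ...     | X , Z , yL≡XuZ =
    Z , simple-++ʳ X (subst Simple yL≡XuZ (l , uq)) ,
    trans (sym (end-++ u X u Z)) (trans (cong (end u) (sym yL≡XuZ)) end≡)

  Departure : List (V G) → V G → Set
  Departure S r = ∃₂ λ a E → a ∈ S × Simple (a ∷ E) × Disjoint G E S × end a E ≡ r

  last-visit : ∀ S x L → Simple (x ∷ L) → Departure S (end x L) ⊎ Disjoint G L S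
  last-visit S x [] _ = inj₂ (λ ())
  last-visit S x (y ∷ L) simple with last-visit S y L (simple-++ʳ [ x ] simple)
  ... | inj₁ departure = inj₁ departure
  ... | inj₂ L∩S with y ∈? S
  ...   | yes y∈S = inj₁ (y , L , y∈S , simple-++ʳ [ x ] simple , L∩S , refl)
  ...   | no y∉S = inj₂ λ { (here refl) → y∉S ; (there p) → L∩S p }

  depart : Connected G → ∀ {S a₀} → a₀ ∈ S → ∀ r → Departure S r
  depart conn {S} {a₀} a₀∈S r with walk⇒path (conn a₀ r)
  ... | L , simple , refl with last-visit S a₀ L simple
  ...   | inj₁ departure = departure
  ...   | inj₂ L∩S = a₀ , L , a₀∈S , simple , L∩S , refl

  spread-front : ∀ {k W C S U₁ a U₂ E} → IsPath G (2 * suc k) W → W ≡ C ++ S →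
    length S ≡ suc (suc k) → W ≡ U₁ ++ a ∷ U₂ → suc k ≤ length U₁ → Simple (a ∷ E) →
    Disjoint G E W → Reaches (suc k) S (end a E)
  spread-front {k} {W} (lenW , simple) W≡CS lenS W≡U k≤U₁ simpleE E∩W
    with split-prefix (suc (suc k)) W (subst (suc (suc k) ≤_) (sym lenW) (s≤s (m≤m+n (suc k) _)))
  ... | F , H , W≡FH , lenF =
    reaches-back (rewind {F = F} {H} simple W≡FH W≡CS lenF lenS)
      (exit {F = F} {H} simple W≡FH lenF W≡U k≤U₁ simpleE E∩W)

  -- From the end window S of a path W of length 2k + 2, every vertex is
  -- reachable: leave W where a departure towards r starts, on whichever side
  -- of it has room for the window.
  spread : Connected G → ∀ {k W C S} → IsPath G (2 * suc k) W → W ≡ C ++ S →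
    length S ≡ suc (suc k) → ∀ r → Reaches (suc k) S r
  spread conn {k} {W} {C} {S} pathW W≡CS lenS r
    with depart conn (proj₂ (some-member (proj₁ pathW))) r
  ... | a , E , a∈W , simpleE , E∩W , refl with ∈-∃++ a∈W
  ... | U₁ , U₂ , W≡U with long-side (suc k) (length U₁) (length U₂) (split-length W≡U (proj₁ pathW))
  ... | inj₁ k≤U₁ = spread-front pathW W≡CS lenS W≡U k≤U₁ simpleE E∩W
  ... | inj₂ k≤U₂ =
    reaches-reverse (exit (simple-reverse (proj₂ pathW)) (trans (cong reverse W≡CS) (reverse-++ C S))
      (trans (length-reverse S) lenS) (trans (cong reverse W≡U) (reverse-split U₁ a U₂))
      (subst (suc k ≤_) (sym (length-reverse U₂)) k≤U₂) simpleE
      (λ e∈E e∈rW → E∩W e∈E (reverse⁻ e∈rW)))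

  -- Entering R′ = X ++ w ∷ Y from Pb = M ∷ʳ w with M off R′, when at least
  -- k + 1 vertices precede w: Pb slides through w and backwards along X onto
  -- the reversed front window of R′, an end window of reverse R′.
  enter-along : Connected G → ∀ {k M w R′ X Y} → IsPath G (2 * suc k) R′ →
    IsPath G (suc k) (M ∷ʳ w) → Disjoint G M R′ → R′ ≡ X ++ w ∷ Y → suc k ≤ length X →
    ∀ r → Reaches (suc k) (M ∷ʳ w) r
  enter-along conn {k} {M} {w} {R′} {X} {Y} pathR′ (lenPb , simplePb) M∩R′ R′≡ k≤X r
    with split-prefix (suc (suc k)) (X ∷ʳ w) (subst (suc (suc k) ≤_) (sym (length-snoc X w)) (s≤s k≤X))
  ... | F , J , Xw≡FJ , lenF =
    reaches-back (slide (M ++ reverse J) simple-route route≡ lenPb lenrF)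
      (spread conn (path-reverse pathR′) rR′≡ lenrF r)
    where
    lenrF : length (reverse F) ≡ suc (suc k)
    lenrF = trans (length-reverse F) lenF
    R′≡Xw++Y : R′ ≡ (X ∷ʳ w) ++ Y
    R′≡Xw++Y = trans R′≡ (sym (++-assoc X [ w ] Y))
    simple-wrX : Simple (w ∷ reverse X)
    simple-wrX = subst Simple (reverse-++ X [ w ])
      (simple-reverse (simple-++ˡ (X ∷ʳ w) (subst Simple R′≡Xw++Y (proj₂ pathR′))))
    simple-route : Simple ((M ∷ʳ w) ++ reverse X)
    simple-route = subst Simple (sym (++-assoc M [ w ] (reverse X)))
      (simple-glue M simplePb simple-wrX
        (λ m∈M m∈rX → M∩R′ m∈M (subst (_ ∈_) (sym R′≡) (∈-++⁺ˡ {xs = X} (reverse⁻ m∈rX)))))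
    route≡ : (M ∷ʳ w) ++ reverse X ≡ (M ++ reverse J) ++ reverse F
    route≡ = begin
      (M ∷ʳ w) ++ reverse X          ≡⟨ ++-assoc M [ w ] (reverse X) ⟩
      M ++ w ∷ reverse X             ≡⟨ cong (M ++_) (sym (reverse-++ X [ w ])) ⟩
      M ++ reverse (X ∷ʳ w)          ≡⟨ cong (λ T → M ++ reverse T) Xw≡FJ ⟩
      M ++ reverse (F ++ J)          ≡⟨ cong (M ++_) (reverse-++ F J) ⟩
      M ++ (reverse J ++ reverse F)  ≡⟨ sym (++-assoc M (reverse J) (reverse F)) ⟩
      (M ++ reverse J) ++ reverse F  ∎
    rR′≡ : reverse R′ ≡ (reverse Y ++ reverse J) ++ reverse F
    rR′≡ = begin
      reverse R′                            ≡⟨ cong reverse R′≡Xw++Y ⟩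
      reverse ((X ∷ʳ w) ++ Y)               ≡⟨ reverse-++ (X ∷ʳ w) Y ⟩
      reverse Y ++ reverse (X ∷ʳ w)         ≡⟨ cong (λ T → reverse Y ++ reverse T) Xw≡FJ ⟩
      reverse Y ++ reverse (F ++ J)         ≡⟨ cong (reverse Y ++_) (reverse-++ F J) ⟩
      reverse Y ++ (reverse J ++ reverse F) ≡⟨ sym (++-assoc (reverse Y) (reverse J) (reverse F)) ⟩
      (reverse Y ++ reverse J) ++ reverse F ∎

  -- Pb = M ∷ʳ w with M off R′ and w on R′ reaches every vertex: enter R′
  -- along the side of w that has room for the window.
  enter : Connected G → ∀ {k M w R′} → IsPath G (2 * suc k) R′ → IsPath G (suc k) (M ∷ʳ w) →
    Disjoint G M R′ → w ∈ R′ → ∀ r → Reaches (suc k) (M ∷ʳ w) r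
  enter conn {k} {M} {w} {R′} pathR′ pathPb M∩R′ w∈R′ r with ∈-∃++ w∈R′
  ... | X , Y , R′≡ with long-side (suc k) (length X) (length Y) (split-length R′≡ (proj₁ pathR′))
  ... | inj₁ k≤X = enter-along conn pathR′ pathPb M∩R′ R′≡ k≤X r
  ... | inj₂ k≤Y =
    enter-along conn (path-reverse pathR′) pathPb (λ m∈M m∈rR′ → M∩R′ m∈M (reverse⁻ m∈rR′))
      (trans (cong reverse R′≡) (reverse-split X w Y)) (subst (suc k ≤_) (sym (length-reverse Y)) k≤Y) r

  -- A step from a path off R′ to a path meeting R′ can only meet R′ in the
  -- newly added end vertex; from there every vertex is reachable.
  fwd-crossing-reaches : Connected G → ∀ {k Pa Pb R′} → IsPath G (2 * suc k) R′ →
    FwdStep G (suc k) Pa Pb → Disjoint G Pa R′ → Any (_∈ R′) Pb → ∀ r → Reaches (suc k) Pb r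
  fwd-crossing-reaches conn pathR′ (v , zs , x , w , refl , refl , _ , pathPb) Pa∩R′ meets r
    with find meets
  ... | y , y∈Pb , y∈R′ with ∈-++⁻ (zs ∷ʳ x) y∈Pb
  ... | inj₁ y∈M = ⊥-elim (Pa∩R′ (there y∈M) y∈R′)
  ... | inj₂ (here refl) = enter conn pathR′ pathPb (λ m∈M → Pa∩R′ (there m∈M)) y∈R′ r

  crossing-reaches : Connected G → ∀ {k Pa Pb R′} → IsPath G (2 * k) R′ →
    Step G k Pa Pb → Disjoint G Pa R′ → Any (_∈ R′) Pb → ∀ r → Reaches k Pb r
  crossing-reaches conn {zero} _ step = ⊥-elim (no-step-at-zero step)
  crossing-reaches conn {suc k} pathR′ (inj₁ s) = fwd-crossing-reaches conn pathR′ s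
  crossing-reaches conn {suc k} pathR′ (inj₂ s) Pa∩R′ meets r =
    reaches-reverse (fwd-crossing-reaches conn pathR′ s (λ p → Pa∩R′ (reverse⁻ p)) (reverse⁺ meets) r)

  meets? : ∀ R′ → Decidable (λ T → Any (_∈ R′) T)
  meets? R′ T = any? (_∈? R′) T

  misses⇒disjoint : ∀ {T R′} → ¬ Any (_∈ R′) T → Disjoint G T R′
  misses⇒disjoint ¬meets t∈T t∈R′ = ¬meets (lose t∈T t∈R′)

  disjoint⇒misses : ∀ {T R′} → Disjoint G R′ T → ¬ Any (_∈ R′) T
  disjoint⇒misses R′∩T meets with find meets
  ... | y , y∈T , y∈R′ = R′∩T y∈R′ y∈T

lemma4 : (G : Graph) → Connected G → (k : ℕ) → (P Q : List (V G)) →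
    IsPath G k P → IsPath G k Q →
    (∃[ R ] (Loose G k P Q R × Reachable G k P R)) →
    ∀ (R : List (V G)) → Loose G k P Q R → Reachable G k P R
lemma4 G conn k P Q _ _ (R′ , (pathR′ , R′∩P , _) , (P₁ , P→P₁ , x , x∈P₁ , x∈R′)) R ((lenR , _) , _)
  with first-crossing (meets? G R′) P→P₁ (disjoint⇒misses G R′∩P) (lose x∈P₁ x∈R′) | some-member lenR
... | Pa , Pb , P→Pa , Pa-misses , Pa→Pb , Pb-meets | r , r∈R
  with crossing-reaches G conn pathR′ Pa→Pb (misses⇒disjoint G Pa-misses) Pb-meets r
... | T , Pb→T , r∈T = T , P→Pa ◅◅ (Pa→Pb ◅ Pb→T) , r , r∈T , r∈R
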